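{- Let $r\geq 3$ be an integer and $\mathcal{B}$ a good choice on $[m]$. Then $$\sum_{X\subseteq[m]}n(\mathcal{B},X)(r-2)^{m-|X|}=(r-2)^{m-2}\sum_{xy\in\binom{[m]}{2}}\left(\frac{r-1}{r-2}\right)^{m_{xy}}.$$
   Context: For $|T|=3$ and $x\in T$, $e_x\in\{0,1\}^T$ has a 1 at $x$ and 0 elsewhere, $\bar e_x=\mathbf 1-e_x$. A choice on $[m]$ is a family $\mathcal{B}=(B_T)_{T\in\binom{[m]}{3}}$ with each $B_T\subseteq\{0,1\}^T$ containing exactly one vector from each pair $\{e_x,\bar e_x\}$, $x\in T$; it is good if no $B_T$ equals $\{e_x\}_{x\in T}$ or $\{\bar e_x\}_{x\in T}$. For $X\subseteq[m]$, $\mathcal{D}_{\mathcal{B}}(X)$ is the directed multigraph on $X$ which, for each 3-subset $T\subseteq X$ and each ordered pair $(x,y)$ of distinct elements of $T$ such that both vectors $u\in\{0,1\}^T$ with $u_x=0,u_y=1$ lie in $B_T$, has one edge $x\to y$ (contributed by $T$). $n(\mathcal{B},X)$ is the number of unordered pairs of distinct $x,y\in X$ with no directed edge between $x$ and $y$ in $\mathcal{D}_{\mathcal{B}}(X)$. For a good choice, each $T$ contributes exactly two directed edges, which share a common vertex, so exactly one pair $\{x,y\}\subseteq T$ is not joined by an edge contributed by $T$; $m_{xy}$ denotes the number of triples $T\ni x,y$ for which $\{x,y\}$ is this pair. -}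

module Defs where

open import Data.Bool using (Bool; true; false; _∧_; _∨_; not; if_then_else_)
open import Data.Nat using (ℕ; zero; suc; _∸_; _≤_; s≤s; z≤n)
open import Data.Fin using (Fin; _<?_)
open import Data.Vec using (Vec; []; _∷_; lookup)
open import Data.List using (List; []; _∷_; _++_; map; filter; length; sum; allFin; concatMap; foldr)
open import Data.Fin.Subset using (Subset; ∣_∣)
open import Data.Integer using (+_)
open import Data.Rational using (ℚ; _/_; _*_; 1ℚ)
open import Relation.Nullary.Decidable using (⌊_⌋)
open import Relation.Binary.PropositionalEquality using (_≡_)
open import Data.Product using (_×_)
open import Relation.Nullary using (¬_)

subsets : (m : ℕ) → List (Subset m)
subsets zero    = [] ∷ []
subsets (suc m) = map (false ∷_) (subsets m) ++ map (true ∷_) (subsets m)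

_∈ᵇ_ : {m : ℕ} → Fin m → Subset m → Bool
x ∈ᵇ T = lookup T x

_⊆ᵇ_ : {m : ℕ} → Subset m → Subset m → Bool
_⊆ᵇ_ {m} T X = foldr _∧_ true (map (λ x → not (x ∈ᵇ T) ∨ (x ∈ᵇ X)) (allFin m))

is3 : {m : ℕ} → Subset m → Bool
is3 T with ∣ T ∣
... | 3 = true
... | _ = false

triples : (m : ℕ) → List (Subset m)
triples m = filter (λ T → Data.Bool._≟_ (is3 T) true) (subsets m)

-- All unordered pairs {x,y} of distinct elements, listed as (x , y) with x < y.
record Pair (m : ℕ) : Set where
  constructor _,,_
  field
    fst : Fin m
    snd : Fin m

pairs : (m : ℕ) → List (Pair m)
pairs m = concatMap (λ x → map (x ,,_)
            (filter (λ y → x <? y) (allFin m))) (allFin m)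

count : {A : Set} → (A → Bool) → List A → ℕ
count p xs = length (filter (λ a → Data.Bool._≟_ (p a) true) xs)

-- A choice on [m]: for every 3-subset T and x ∈ T, B T x = true means
-- e_x ∈ B_T, and B T x = false means ē_x ∈ B_T (exactly one of the pair).
-- Values of B at non-3-subsets T or at x ∉ T are irrelevant.
Choice : ℕ → Set
Choice m = Subset m → Fin m → Bool

eIn : {m : ℕ} → Choice m → Subset m → Fin m → Bool
eIn B T x = B T x

ēIn : {m : ℕ} → Choice m → Subset m → Fin m → Bool
ēIn B T x = not (B T x)

Good : {m : ℕ} → Choice m → Set
Good {m} B = (T : Subset m) → ∣ T ∣ ≡ 3 →
  (¬ ((x : Fin m) → lookup T x ≡ true → B T x ≡ true)) ×
  (¬ ((x : Fin m) → lookup T x ≡ true → B T x ≡ false))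

-- T (a 3-subset) contributes an edge x → y iff x,y ∈ T, x ≠ y, and both
-- vectors u ∈ {0,1}^T with u_x = 0, u_y = 1 lie in B_T.  With z the third
-- element of T these two vectors are e_y (u_z = 0) and ē_x (u_z = 1).
-- (x ≠ y is forced: e_x and ē_x cannot both be in B_T.)
edgeFrom : {m : ℕ} → Choice m → Subset m → Fin m → Fin m → Bool
edgeFrom B T x y = (x ∈ᵇ T) ∧ (y ∈ᵇ T) ∧ eIn B T y ∧ ēIn B T x

joinedBy : {m : ℕ} → Choice m → Subset m → Fin m → Fin m → Bool
joinedBy B T x y = edgeFrom B T x y ∨ edgeFrom B T y x

joinedIn : {m : ℕ} → Choice m → Subset m → Fin m → Fin m → Bool
joinedIn {m} B X x y =
  foldr _∨_ false (map (λ T → (T ⊆ᵇ X) ∧ joinedBy B T x y) (triples m))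

nB : {m : ℕ} → Choice m → Subset m → ℕ
nB {m} B X = count (λ p → (Pair.fst p ∈ᵇ X) ∧ (Pair.snd p ∈ᵇ X)
                          ∧ not (joinedIn B X (Pair.fst p) (Pair.snd p)))
                   (pairs m)

mxy : {m : ℕ} → Choice m → Fin m → Fin m → ℕ
mxy {m} B x y = count (λ T → (x ∈ᵇ T) ∧ (y ∈ᵇ T) ∧ not (joinedBy B T x y))
                      (triples m)

ℕtoℚ : ℕ → ℚ
ℕtoℚ n = + n / 1

infixr 8 _^ℚ_
_^ℚ_ : ℚ → ℕ → ℚ
q ^ℚ zero  = 1ℚ
q ^ℚ suc n = q * (q ^ℚ n)

sumℚ : List ℚ → ℚ
sumℚ = foldr Data.Rational._+_ (ℕtoℚ 0)

ratio : (r : ℕ) → 3 ≤ r → ℚ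
ratio zero ()
ratio (suc zero) (s≤s ())
ratio (suc (suc zero)) (s≤s (s≤s ()))
ratio (suc (suc (suc k))) _ = + (suc (suc k)) / suc k

-- Counting twice, the left-hand side is the sum over pairs {x,y} of
-- Σ_X (r-2)^(m-|X|) [x,y ∈ X and x,y are not joined in D(X)].  An edge between
-- x and y can only be contributed by a triple {x,y,z} ⊆ X, so the condition on X
-- splits into independent conditions on its elements: x and y lie in X, and
-- every other z ∈ X leaves x and y unjoined in the triple {x,y,z}.  Hence the
-- weighted sum over X factorises over the elements of [m]: x and y contribute 1,
-- each of the m_xy elements z whose triple leaves x,y unjoined contributes
-- (r-2) + 1 (z ∉ X or z ∈ X), and each of the remaining m-2-m_xy elements
-- contributes r-2 (only z ∉ X).  So the pair contributes
-- (r-1)^m_xy (r-2)^(m-2-m_xy) = (r-2)^(m-2) ((r-1)/(r-2))^m_xy.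

module Submission where

open import Defs
open import Algebra.Properties.CommutativeSemigroup using (interchange)
open import Data.Bool using (Bool; true; false; _∧_; _∨_; not; if_then_else_; T)
import Data.Bool as Bool
open import Data.Bool.ListAction using (and)
open import Data.Bool.Properties using (T-∧; T-∨; T-≡; ∧-identityʳ; ∧-zeroʳ)
open import Data.Empty using (⊥-elim)
open import Data.Fin using (Fin; zero; suc; _≟_; _<?_)
import Data.Fin.Properties as Fin
open import Data.Fin.Subset using (Subset; ∣_∣)
import Data.Integer as ℤ
import Data.Integer.Properties as ℤ
open import Data.Integer.Solver using (module +-*-Solver)
open import Data.List using (List; []; _∷_; _++_; map; filter; tabulate; allFin)
open import Data.List.Membership.Propositional using (_∈_; find; lose)
open import Data.List.Membership.Propositional.Properties using (∈-map⁺; ∈-++⁺ˡ; ∈-++⁺ʳ; ∈-filter⁺; ∈-filter⁻)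
open import Data.List.Properties using (map-++; map-∘; map-cong; map-cong-local; map-tabulate; tabulate-cong)
open import Data.List.Relation.Unary.All using (All)
import Data.List.Relation.Unary.All as All
open import Data.List.Relation.Unary.All.Properties using (concat⁺; map⁺; all-filter)
open import Data.List.Relation.Unary.Any using (here)
open import Data.List.Relation.Unary.Any.Properties using (any⁺; any⁻)
open import Data.Nat using (ℕ; zero; suc; _+_; _*_; _∸_; _^_; _≤_; s≤s)
open import Data.Nat.ListAction using (sum; product)
open import Data.Nat.ListAction.Properties using (sum-++)
open import Data.Nat.Properties
  using (+-comm; +-identityʳ; +-suc; +-cancelˡ-≡; *-comm; *-identityʳ; *-zeroʳ; *-distribˡ-+; *-distribʳ-+;
         m+n∸m≡n; suc-injective; +-commutativeSemigroup; *-commutativeSemigroup)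
open import Data.Product using (∃; _×_; _,_; proj₁; proj₂)
open import Data.Rational using (ℚ; toℚᵘ; _/_)
import Data.Rational as ℚ
open import Data.Rational.Properties using (toℚᵘ-injective; toℚᵘ-fromℚᵘ; toℚᵘ-homo-+; toℚᵘ-homo-*)
import Data.Rational.Properties as ℚ
open import Data.Rational.Solver using () renaming (module +-*-Solver to ℚ-Solver)
open import Data.Rational.Unnormalised using (mkℚᵘ; *≡*)
import Data.Rational.Unnormalised as ℚᵘ
import Data.Rational.Unnormalised.Properties as ℚᵘ
open import Data.Sum using (_⊎_; inj₁; inj₂)
import Data.Sum as Sum
open import Data.Vec using ([]; _∷_; lookup)
import Data.Vec as Vec
open import Data.Vec.Properties using (∷-injective; ≡-dec; lookup∘tabulate; tabulate∘lookup)
import Data.Vec.Properties as Vec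
open import Function using (_∘_; id; Equivalence; case_of_)
open import Relation.Binary.PropositionalEquality
open import Relation.Nullary using (¬_; does; Dec; yes; no)

private variable
  A C : Set
  m n : ℕ

⟦_⟧ : Bool → ℕ
⟦ true  ⟧ = 1
⟦ false ⟧ = 0

⟦⟧-true : {b : Bool} → T b → ⟦ b ⟧ ≡ 1
⟦⟧-true {true} _ = refl

T-injective : {a b : Bool} → (T a → T b) → (T b → T a) → a ≡ b
T-injective {false} {false} _ _ = refl
T-injective {false} {true}  _ b⇒a = ⊥-elim (b⇒a _)
T-injective {true}  {false} a⇒b _ = ⊥-elim (a⇒b _)
T-injective {true}  {true}  _ _ = refl

T-∧⁺ : {a b : Bool} → T a → T b → T (a ∧ b)
T-∧⁺ ta tb = Equivalence.from T-∧ (ta , tb)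

T-∧⁻ : {a b : Bool} → T (a ∧ b) → T a × T b
T-∧⁻ = Equivalence.to T-∧

T-∨⁺ : {a b : Bool} → T a ⊎ T b → T (a ∨ b)
T-∨⁺ = Equivalence.from T-∨

T-∨⁻ : {a b : Bool} → T (a ∨ b) → T a ⊎ T b
T-∨⁻ = Equivalence.to T-∨

T-not⁺ : {b : Bool} → ¬ T b → T (not b)
T-not⁺ {false} _  = _
T-not⁺ {true}  ¬b = ¬b _

T-not⁻ : {b : Bool} → T (not b) → ¬ T b
T-not⁻ {false} _ ()

T-⇒⁺ : {a b : Bool} → (T a → T b) → T (not a ∨ b)
T-⇒⁺ {false} _   = _
T-⇒⁺ {true}  a⇒b = a⇒b _

T-⇒⁻ : {a b : Bool} → T (not a ∨ b) → T a → T b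
T-⇒⁻ {true} b _ = b

≟-sound : (i j : Fin n) → T (does (i ≟ j)) → i ≡ j
≟-sound i j with i ≟ j
... | yes i≡j = λ _ → i≡j
... | no  _   = λ ()

≟-refl : (i : Fin n) → T (does (i ≟ i))
≟-refl i with i ≟ i
... | yes _   = _
... | no  i≢i = i≢i refl

+-interchange : ∀ a b c d → a + b + (c + d) ≡ a + c + (b + d)
+-interchange = interchange +-commutativeSemigroup

*-interchange : ∀ a b c d → a * b * (c * d) ≡ a * c * (b * d)
*-interchange = interchange *-commutativeSemigroup

sum-map-zero : {f : A → ℕ} → (∀ a → f a ≡ 0) → (xs : List A) → sum (map f xs) ≡ 0
sum-map-zero f≡0 []       = refl
sum-map-zero f≡0 (x ∷ xs) = cong₂ _+_ (f≡0 x) (sum-map-zero f≡0 xs)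

sum-map-+ : (f g : A → ℕ) (xs : List A) →
            sum (map (λ a → f a + g a) xs) ≡ sum (map f xs) + sum (map g xs)
sum-map-+ f g []       = refl
sum-map-+ f g (x ∷ xs) =
  trans (cong (f x + g x +_) (sum-map-+ f g xs)) (+-interchange (f x) (g x) _ _)

sum-map-*ˡ : (c : ℕ) (f : A → ℕ) (xs : List A) →
             sum (map (λ a → c * f a) xs) ≡ c * sum (map f xs)
sum-map-*ˡ c f []       = sym (*-zeroʳ c)
sum-map-*ˡ c f (x ∷ xs) =
  trans (cong (c * f x +_) (sum-map-*ˡ c f xs)) (sym (*-distribˡ-+ c (f x) _))

sum-map-comm : (G : A → C → ℕ) (xs : List A) (ys : List C) →
               sum (map (λ a → sum (map (G a) ys)) xs) ≡ sum (map (λ b → sum (map (λ a → G a b) xs)) ys)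
sum-map-comm G []       ys = sym (sum-map-zero (λ _ → refl) ys)
sum-map-comm G (x ∷ xs) ys =
  trans (cong (sum (map (G x) ys) +_) (sum-map-comm G xs ys))
        (sym (sum-map-+ (G x) (λ b → sum (map (λ a → G a b) xs)) ys))

count≡sum : (p : A → Bool) (xs : List A) → count p xs ≡ sum (map (λ a → ⟦ p a ⟧) xs)
count≡sum p []       = refl
count≡sum p (x ∷ xs) with p x
... | true  = cong suc (count≡sum p xs)
... | false = count≡sum p xs

count-filter : (p q : A → Bool) (xs : List A) →
               count p (filter (λ a → q a Bool.≟ true) xs) ≡ sum (map (λ a → ⟦ q a ∧ p a ⟧) xs)
count-filter p q []       = refl
count-filter p q (x ∷ xs) with q x
... | false = count-filter p q xs
... | true with p x
...   | true  = cong suc (count-filter p q xs)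
...   | false = count-filter p q xs

sum-map-count-comm : (w : A → ℕ) (P : A → C → Bool) (xs : List A) (ys : List C) →
  sum (map (λ a → count (P a) ys * w a) xs) ≡ sum (map (λ b → sum (map (λ a → w a * ⟦ P a b ⟧) xs)) ys)
sum-map-count-comm w P xs ys =
  trans (cong sum (map-cong expand xs)) (sum-map-comm (λ a b → w a * ⟦ P a b ⟧) xs ys)
  where
  expand : ∀ a → count (P a) ys * w a ≡ sum (map (λ b → w a * ⟦ P a b ⟧) ys)
  expand a = trans (*-comm (count (P a) ys) (w a))
                   (trans (cong (w a *_) (count≡sum (P a) ys)) (sym (sum-map-*ˡ (w a) (λ b → ⟦ P a b ⟧) ys)))

-- Sums, products and counts indexed by Fin n

∑ : (Fin n → ℕ) → ℕ
∑ f = sum (tabulate f)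

∏ : (Fin n → ℕ) → ℕ
∏ f = product (tabulate f)

#[_] : (Fin n → Bool) → ℕ
#[ p ] = ∑ (λ i → ⟦ p i ⟧)

∑-cong : {f g : Fin n → ℕ} → (∀ i → f i ≡ g i) → ∑ f ≡ ∑ g
∑-cong f≗g = cong sum (tabulate-cong f≗g)

∏-cong : {f g : Fin n → ℕ} → (∀ i → f i ≡ g i) → ∏ f ≡ ∏ g
∏-cong f≗g = cong product (tabulate-cong f≗g)

#-cong : {p q : Fin n → Bool} → (∀ i → p i ≡ q i) → #[ p ] ≡ #[ q ]
#-cong p≗q = ∑-cong (cong ⟦_⟧ ∘ p≗q)

sum-map-∑-comm : (G : A → Fin n → ℕ) (xs : List A) →
                 sum (map (λ a → ∑ (G a)) xs) ≡ ∑ (λ i → sum (map (λ a → G a i) xs))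
sum-map-∑-comm {n = n} G xs = begin
  sum (map (λ a → ∑ (G a)) xs)                              ≡⟨ cong sum (map-cong (λ a → cong sum (as-map (G a))) xs) ⟩
  sum (map (λ a → sum (map (G a) (allFin n))) xs)           ≡⟨ sum-map-comm G xs (allFin n) ⟩
  sum (map (λ i → sum (map (λ a → G a i) xs)) (allFin n))   ≡⟨ cong sum (as-map _) ⟨
  ∑ (λ i → sum (map (λ a → G a i) xs))                      ∎
  where
  open ≡-Reasoning
  as-map : (f : Fin n → ℕ) → tabulate f ≡ map f (allFin n)
  as-map f = sym (map-tabulate id f)

∑-zero : (f : Fin n → ℕ) → (∀ i → f i ≡ 0) → ∑ f ≡ 0
∑-zero {zero}  f f≡0 = refl
∑-zero {suc n} f f≡0 = cong₂ _+_ (f≡0 zero) (∑-zero (f ∘ suc) (f≡0 ∘ suc))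

∑-δ : (f : Fin n → ℕ) (j : Fin n) → (∀ i → i ≢ j → f i ≡ 0) → ∑ f ≡ f j
∑-δ f zero    f≡0 = trans (cong (f zero +_) (∑-zero (f ∘ suc) (λ i → f≡0 (suc i) λ ()))) (+-identityʳ _)
∑-δ f (suc j) f≡0 = trans (cong (_+ ∑ (f ∘ suc)) (f≡0 zero λ ()))
                          (∑-δ (f ∘ suc) j (λ i i≢j → f≡0 (suc i) (i≢j ∘ Fin.suc-injective)))

∏-* : (f g : Fin n → ℕ) → ∏ (λ i → f i * g i) ≡ ∏ f * ∏ g
∏-* {zero}  f g = refl
∏-* {suc n} f g = trans (cong (f zero * g zero *_) (∏-* (f ∘ suc) (g ∘ suc))) (*-interchange (f zero) (g zero) _ _)

∏-if : (a : ℕ) (p : Fin n → Bool) → ∏ (λ i → if p i then a else 1) ≡ a ^ #[ p ]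
∏-if {zero}  a p = refl
∏-if {suc n} a p with p zero
... | true  = cong (a *_) (∏-if a (p ∘ suc))
... | false = trans (+-identityʳ _) (∏-if a (p ∘ suc))

⟦and⟧≡∏ : (f : Fin n → Bool) → ⟦ and (tabulate f) ⟧ ≡ ∏ (λ i → ⟦ f i ⟧)
⟦and⟧≡∏ {zero}  f = refl
⟦and⟧≡∏ {suc n} f with f zero
... | true  = trans (⟦and⟧≡∏ (f ∘ suc)) (sym (+-identityʳ _))
... | false = refl

T-and-tabulate⁺ : (f : Fin n → Bool) → (∀ i → T (f i)) → T (and (tabulate f))
T-and-tabulate⁺ {zero}  f all-f = _
T-and-tabulate⁺ {suc n} f all-f =
  T-∧⁺ (all-f zero) (T-and-tabulate⁺ (f ∘ suc) (all-f ∘ suc))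

T-and-tabulate⁻ : (f : Fin n → Bool) → T (and (tabulate f)) → ∀ i → T (f i)
T-and-tabulate⁻ f and-f zero    = proj₁ (T-∧⁻ and-f)
T-and-tabulate⁻ f and-f (suc i) = T-and-tabulate⁻ (f ∘ suc) (proj₂ (T-∧⁻ and-f)) i

#-split : (p q : Fin n → Bool) → #[ p ] ≡ #[ (λ i → p i ∧ q i) ] + #[ (λ i → p i ∧ not (q i)) ]
#-split {zero}  p q = refl
#-split {suc n} p q with p zero | q zero
... | false | _     = #-split (p ∘ suc) (q ∘ suc)
... | true  | true  = cong suc (#-split (p ∘ suc) (q ∘ suc))
... | true  | false = trans (cong suc (#-split (p ∘ suc) (q ∘ suc))) (sym (+-suc _ _))

#-complement : (p : Fin n → Bool) → #[ p ] + #[ not ∘ p ] ≡ n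
#-complement {zero}  p = refl
#-complement {suc n} p with p zero
... | true  = cong suc (#-complement (p ∘ suc))
... | false = trans (+-suc _ _) (cong suc (#-complement (p ∘ suc)))

#-singleton : (j : Fin n) → #[ (λ i → does (i ≟ j)) ] ≡ 1
#-singleton {suc n} zero = cong suc (∑-zero {n} _ (λ _ → refl))
#-singleton (suc j)      = #-singleton j

#-zero : (p : Fin n → Bool) → #[ p ] ≡ 0 → ∀ i → ¬ T (p i)
#-zero {suc n} p #p≡0 i with p zero in p0
#-zero p #p≡0 zero    | false = subst (¬_ ∘ T) (sym p0) id
#-zero p #p≡0 (suc i) | false = #-zero (p ∘ suc) #p≡0 i

#-one : (p : Fin n → Bool) → #[ p ] ≡ 1 → ∃ λ j → T (p j) × ∀ i → T (p i) → i ≡ j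
#-one {suc n} p #p≡1 with p zero in p0
... | true  = zero , subst T (sym p0) _ , only-zero
  where
  only-zero : ∀ i → T (p i) → i ≡ zero
  only-zero zero    _   = refl
  only-zero (suc i) pi = ⊥-elim (#-zero (p ∘ suc) (suc-injective #p≡1) i pi)
... | false with #-one (p ∘ suc) #p≡1
...   | j , pj , unique = suc j , pj , only-j
  where
  only-j : ∀ i → T (p i) → i ≡ suc j
  only-j zero    pi = ⊥-elim (subst T p0 pi)
  only-j (suc i) pi = cong suc (unique i pi)

#-∨-disjoint : (p q : Fin n → Bool) → (∀ i → ¬ T (p i ∧ q i)) → #[ (λ i → p i ∨ q i) ] ≡ #[ p ] + #[ q ]
#-∨-disjoint p q disjoint = trans (#-split (λ i → p i ∨ q i) p) (cong₂ _+_ (#-cong left) (#-cong right))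
  where
  left : ∀ i → (p i ∨ q i) ∧ p i ≡ p i
  left i with p i
  ... | true  = refl
  ... | false = ∧-zeroʳ (q i)
  right : ∀ i → (p i ∨ q i) ∧ not (p i) ≡ q i
  right i with p i | q i | disjoint i
  ... | true  | true  | ¬both = ⊥-elim (¬both _)
  ... | true  | false | _     = refl
  ... | false | _     | _     = ∧-identityʳ _

∣∣≡# : (X : Subset n) → ∣ X ∣ ≡ #[ lookup X ]
∣∣≡# []           = refl
∣∣≡# (true  ∷ X)  = cong suc (∣∣≡# X)
∣∣≡# (false ∷ X)  = ∣∣≡# X

^[n∸∣X∣]≡∏ : (s : ℕ) (X : Subset n) → s ^ (n ∸ ∣ X ∣) ≡ ∏ (λ i → if lookup X i then 1 else s)
^[n∸∣X∣]≡∏ {n} s X = begin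
  s ^ (n ∸ ∣ X ∣)                                    ≡⟨ cong (λ k → s ^ (k ∸ ∣ X ∣)) (#-complement (lookup X)) ⟨
  s ^ (#[ lookup X ] + #[ not ∘ lookup X ] ∸ ∣ X ∣)  ≡⟨ cong (λ k → s ^ (k + #[ not ∘ lookup X ] ∸ ∣ X ∣)) (∣∣≡# X) ⟨
  s ^ (∣ X ∣ + #[ not ∘ lookup X ] ∸ ∣ X ∣)          ≡⟨ cong (s ^_) (m+n∸m≡n ∣ X ∣ _) ⟩
  s ^ #[ not ∘ lookup X ]                            ≡⟨ ∏-if s (not ∘ lookup X) ⟨
  ∏ (λ i → if not (lookup X i) then s else 1)        ≡⟨ ∏-cong (λ i → if-not (lookup X i)) ⟩
  ∏ (λ i → if lookup X i then 1 else s)              ∎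
  where
  open ≡-Reasoning
  if-not : ∀ b → (if not b then s else 1) ≡ (if b then 1 else s)
  if-not true  = refl
  if-not false = refl

-- Sums over all subsets

∈-subsets : (S : Subset n) → S ∈ subsets n
∈-subsets []          = here refl
∈-subsets {suc n} (false ∷ S) = ∈-++⁺ˡ (∈-map⁺ (false ∷_) (∈-subsets S))
∈-subsets {suc n} (true  ∷ S) = ∈-++⁺ʳ (map (false ∷_) (subsets n)) (∈-map⁺ (true ∷_) (∈-subsets S))

sum-subsets-suc : (f : Subset (suc n) → ℕ) →
  sum (map f (subsets (suc n))) ≡ sum (map (f ∘ (false ∷_)) (subsets n)) + sum (map (f ∘ (true ∷_)) (subsets n))
sum-subsets-suc {n} f = begin
  sum (map f (map (false ∷_) (subsets n) ++ map (true ∷_) (subsets n)))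
    ≡⟨ cong sum (map-++ f (map (false ∷_) (subsets n)) _) ⟩
  sum (map f (map (false ∷_) (subsets n)) ++ map f (map (true ∷_) (subsets n)))
    ≡⟨ sum-++ (map f (map (false ∷_) (subsets n))) _ ⟩
  sum (map f (map (false ∷_) (subsets n))) + sum (map f (map (true ∷_) (subsets n)))
    ≡⟨ cong₂ _+_ (cong sum (map-∘ (subsets n))) (cong sum (map-∘ (subsets n))) ⟨
  sum (map (f ∘ (false ∷_)) (subsets n)) + sum (map (f ∘ (true ∷_)) (subsets n)) ∎
  where open ≡-Reasoning

sum-subsets-δ : (f : Subset n → ℕ) (S : Subset n) → (∀ X → X ≢ S → f X ≡ 0) → sum (map f (subsets n)) ≡ f S
sum-subsets-δ f []      f≡0 = +-identityʳ (f [])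
sum-subsets-δ f (b ∷ S) f≡0 = trans (sum-subsets-suc f) (split b f≡0)
  where
  here-δ : ∀ b → (∀ X → X ≢ b ∷ S → f X ≡ 0) → sum (map (f ∘ (b ∷_)) (subsets _)) ≡ f (b ∷ S)
  here-δ b f≡0 = sum-subsets-δ (f ∘ (b ∷_)) S (λ X X≢S → f≡0 (b ∷ X) (X≢S ∘ proj₂ ∘ ∷-injective))
  elsewhere : ∀ {b c} → b ≢ c → (∀ X → X ≢ b ∷ S → f X ≡ 0) → sum (map (f ∘ (c ∷_)) (subsets _)) ≡ 0
  elsewhere b≢c f≡0 = sum-map-zero (λ X → f≡0 (_ ∷ X) (b≢c ∘ sym ∘ proj₁ ∘ ∷-injective)) (subsets _)
  split : ∀ b → (∀ X → X ≢ b ∷ S → f X ≡ 0) →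
          sum (map (f ∘ (false ∷_)) (subsets _)) + sum (map (f ∘ (true ∷_)) (subsets _)) ≡ f (b ∷ S)
  split false f≡0 = trans (cong₂ _+_ (here-δ false f≡0) (elsewhere (λ ()) f≡0)) (+-identityʳ _)
  split true  f≡0 = cong₂ _+_ (elsewhere (λ ()) f≡0) (here-δ true f≡0)

sum-subsets-∏ : (g : Fin n → Bool → ℕ) →
  sum (map (λ X → ∏ (λ i → g i (lookup X i))) (subsets n)) ≡ ∏ (λ i → g i false + g i true)
sum-subsets-∏ {zero}  g = refl
sum-subsets-∏ {suc n} g = begin
  sum (map (λ X → ∏ (λ i → g i (lookup X i))) (subsets (suc n)))
    ≡⟨ sum-subsets-suc (λ X → ∏ (λ i → g i (lookup X i))) ⟩
  sum (map (λ X → g zero false * rest X) (subsets n)) + sum (map (λ X → g zero true * rest X) (subsets n))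
    ≡⟨ cong₂ _+_ (sum-map-*ˡ (g zero false) rest (subsets n)) (sum-map-*ˡ (g zero true) rest (subsets n)) ⟩
  g zero false * sum (map rest (subsets n)) + g zero true * sum (map rest (subsets n))
    ≡⟨ *-distribʳ-+ (sum (map rest (subsets n))) (g zero false) (g zero true) ⟨
  (g zero false + g zero true) * sum (map rest (subsets n))
    ≡⟨ cong ((g zero false + g zero true) *_) (sum-subsets-∏ (g ∘ suc)) ⟩
  ∏ (λ i → g i false + g i true) ∎
  where
  open ≡-Reasoning
  rest : Subset n → ℕ
  rest X = ∏ (λ i → g (suc i) (lookup X i))

_≟ˢ_ : (S X : Subset n) → Dec (S ≡ X)
_≟ˢ_ = ≡-dec Bool._≟_

sum-subsets-image : (P : Subset m → Bool) (e : Fin n → Subset m) (Z : Fin n → Bool) →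
  (∀ S → T (P S) → ∃ λ z → T (Z z) × S ≡ e z) →
  (∀ z → T (Z z) → T (P (e z))) →
  (∀ z w → T (Z z) → T (Z w) → e z ≡ e w → z ≡ w) →
  sum (map (λ S → ⟦ P S ⟧) (subsets m)) ≡ #[ Z ]
sum-subsets-image {m} {n} P e Z P⇒image image⇒P e-injective = begin
  sum (map (λ S → ⟦ P S ⟧) (subsets m))              ≡⟨ cong sum (map-cong ⟦P⟧≡∑δ (subsets m)) ⟩
  sum (map (λ S → ∑ (δ S)) (subsets m))              ≡⟨ sum-map-∑-comm δ (subsets m) ⟩
  ∑ (λ z → sum (map (λ S → δ S z) (subsets m)))      ≡⟨ ∑-cong (λ z → sum-subsets-δ (λ S → δ S z) (e z) (δ-off-image z)) ⟩
  ∑ (λ z → δ (e z) z)                                ≡⟨ ∑-cong δ-on-image ⟩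
  #[ Z ]                                             ∎
  where
  open ≡-Reasoning
  δ : Subset m → Fin n → ℕ
  δ S z = if does (S ≟ˢ e z) then ⟦ Z z ⟧ else 0

  δ-on-image : ∀ z → δ (e z) z ≡ ⟦ Z z ⟧
  δ-on-image z with e z ≟ˢ e z
  ... | yes _   = refl
  ... | no ez≢ez = ⊥-elim (ez≢ez refl)

  δ-off-image : ∀ z S → S ≢ e z → δ S z ≡ 0
  δ-off-image z S S≢ez with S ≟ˢ e z
  ... | yes S≡ez = ⊥-elim (S≢ez S≡ez)
  ... | no _     = refl

  δ-outside-P : ∀ S z → ¬ T (P S) → δ S z ≡ 0
  δ-outside-P S z ¬PS with S ≟ˢ e z | Z z in Zz
  ... | no _      | _     = refl
  ... | yes _     | false = refl
  ... | yes refl  | true  = ⊥-elim (¬PS (image⇒P z (subst T (sym Zz) _)))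

  ⟦P⟧≡∑δ : ∀ S → ⟦ P S ⟧ ≡ ∑ (δ S)
  ⟦P⟧≡∑δ S with P S in PS
  ... | false = sym (∑-zero (δ S) (λ z → δ-outside-P S z (subst T PS)))
  ... | true with P⇒image S (subst T (sym PS) _)
  ...   | z₀ , Zz₀ , refl = sym (trans (∑-δ (δ S) z₀ off) (trans (δ-on-image z₀) (⟦⟧-true Zz₀)))
    where
    off : ∀ z → z ≢ z₀ → δ S z ≡ 0
    off z z≢z₀ with e z₀ ≟ˢ e z | Z z in Zz
    ... | no _          | _     = refl
    ... | yes _         | false = refl
    ... | yes ez₀≡ez    | true  = ⊥-elim (z≢z₀ (e-injective z z₀ (subst T (sym Zz) _) Zz₀ (sym ez₀≡ez)))

is3⇒∣∣≡3 : (S : Subset n) → is3 S ≡ true → ∣ S ∣ ≡ 3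
is3⇒∣∣≡3 S is3S with ∣ S ∣
... | 3 = refl
... | 0 = case is3S of λ ()
... | 1 = case is3S of λ ()
... | 2 = case is3S of λ ()
... | suc (suc (suc (suc _))) = case is3S of λ ()

∣∣≡3⇒is3 : (S : Subset n) → ∣ S ∣ ≡ 3 → is3 S ≡ true
∣∣≡3⇒is3 S ∣S∣≡3 rewrite ∣S∣≡3 = refl

∈-triples⁻ : {S : Subset n} → S ∈ triples n → ∣ S ∣ ≡ 3
∈-triples⁻ {n} {S} S∈ = is3⇒∣∣≡3 S (proj₂ (∈-filter⁻ (λ S → is3 S Bool.≟ true) {xs = subsets n} S∈))

∈-triples⁺ : (S : Subset n) → ∣ S ∣ ≡ 3 → S ∈ triples n
∈-triples⁺ S ∣S∣≡3 = ∈-filter⁺ (λ S → is3 S Bool.≟ true) (∈-subsets S) (∣∣≡3⇒is3 S ∣S∣≡3)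

⊆ᵇ⁺ : (S X : Subset n) → (∀ i → T (lookup S i) → T (lookup X i)) → T (S ⊆ᵇ X)
⊆ᵇ⁺ S X S⊆X = subst T (cong and (sym (map-tabulate id (λ i → not (lookup S i) ∨ lookup X i)))) (T-and-tabulate⁺ _ (λ i → T-⇒⁺ (S⊆X i)))

⊆ᵇ⁻ : (S X : Subset n) → T (S ⊆ᵇ X) → ∀ i → T (lookup S i) → T (lookup X i)
⊆ᵇ⁻ S X S⊆X i = T-⇒⁻ (T-and-tabulate⁻ _ (subst T (cong and (map-tabulate id (λ i → not (lookup S i) ∨ lookup X i))) S⊆X) i)

joinedBy⇒∈ : (B : Choice n) (S : Subset n) {x y : Fin n} → T (joinedBy B S x y) → T (lookup S x) × T (lookup S y)
joinedBy⇒∈ B S {x} {y} joined with lookup S x | lookup S y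
joinedBy⇒∈ B S ()     | false | false
joinedBy⇒∈ B S ()     | false | true
joinedBy⇒∈ B S ()     | true  | false
joinedBy⇒∈ B S joined | true  | true  = _ , _

-- Triples through a pair

onPair : Fin n → Fin n → Fin n → Bool
onPair x y i = does (i ≟ x) ∨ does (i ≟ y)

onPair-x : (x y : Fin n) → T (onPair x y x)
onPair-x x y = T-∨⁺ (inj₁ (≟-refl x))

onPair-y : (x y : Fin n) → T (onPair x y y)
onPair-y x y = T-∨⁺ (inj₂ (≟-refl y))

onPair⁻ : (x y i : Fin n) → T (onPair x y i) → i ≡ x ⊎ i ≡ y
onPair⁻ x y i on = Sum.map (≟-sound i x) (≟-sound i y) (T-∨⁻ on)

pair⊆ : (S : Subset n) {x y : Fin n} → T (lookup S x) → T (lookup S y) → ∀ i → T (onPair x y i) → T (lookup S i)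
pair⊆ S {x} {y} x∈S y∈S i i∈xy with onPair⁻ x y i i∈xy
... | inj₁ refl = x∈S
... | inj₂ refl = y∈S

triple : Fin n → Fin n → Fin n → Subset n
triple x y z = Vec.tabulate (λ i → onPair x y i ∨ does (i ≟ z))

lookup-triple : (x y z i : Fin n) → lookup (triple x y z) i ≡ onPair x y i ∨ does (i ≟ z)
lookup-triple x y z = lookup∘tabulate _

pair⊆triple : (x y z i : Fin n) → T (onPair x y i) → T (lookup (triple x y z) i)
pair⊆triple x y z i on rewrite lookup-triple x y z i = T-∨⁺ (inj₁ on)

z∈triple : (x y z : Fin n) → T (lookup (triple x y z) z)
z∈triple x y z rewrite lookup-triple x y z z = T-∨⁺ (inj₂ (≟-refl z))

∈-triple⁻ : (x y z i : Fin n) → T (lookup (triple x y z) i) → T (onPair x y i) ⊎ i ≡ z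
∈-triple⁻ x y z i i∈ rewrite lookup-triple x y z i = Sum.map₂ (≟-sound i z) (T-∨⁻ i∈)

triple-injective : {x y z w : Fin n} → ¬ T (onPair x y z) → triple x y z ≡ triple x y w → z ≡ w
triple-injective {x = x} {y} {z} {w} z∉xy eq with ∈-triple⁻ x y w z (subst (λ S → T (lookup S z)) eq (z∈triple x y z))
... | inj₁ z∈xy = ⊥-elim (z∉xy z∈xy)
... | inj₂ z≡w  = z≡w

module _ {x y : Fin n} (x≢y : x ≢ y) where

  #-onPair : #[ onPair x y ] ≡ 2
  #-onPair = trans (#-∨-disjoint _ _ disjoint) (cong₂ _+_ (#-singleton x) (#-singleton y))
    where
    disjoint : ∀ i → ¬ T (does (i ≟ x) ∧ does (i ≟ y))
    disjoint i both with T-∧⁻ {does (i ≟ x)} both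
    ... | i≡x , i≡y = x≢y (trans (sym (≟-sound i x i≡x)) (≟-sound i y i≡y))

  ∣triple∣ : {z : Fin n} → ¬ T (onPair x y z) → ∣ triple x y z ∣ ≡ 3
  ∣triple∣ {z} z∉xy = begin
    ∣ triple x y z ∣                                  ≡⟨ ∣∣≡# (triple x y z) ⟩
    #[ lookup (triple x y z) ]                        ≡⟨ #-cong (lookup-triple x y z) ⟩
    #[ (λ i → onPair x y i ∨ does (i ≟ z)) ]          ≡⟨ #-∨-disjoint (onPair x y) (λ i → does (i ≟ z)) disjoint ⟩
    #[ onPair x y ] + #[ (λ i → does (i ≟ z)) ]       ≡⟨ cong₂ _+_ #-onPair (#-singleton z) ⟩
    3                                                 ∎
    where
    open ≡-Reasoning
    disjoint : ∀ i → ¬ T (onPair x y i ∧ does (i ≟ z))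
    disjoint i both with T-∧⁻ {onPair x y i} both
    ... | i∈xy , i≡z = z∉xy (subst (T ∘ onPair x y) (≟-sound i z i≡z) i∈xy)

  #-outside-pair : (S : Subset n) → ∣ S ∣ ≡ 3 → T (lookup S x) → T (lookup S y) →
                   #[ (λ i → lookup S i ∧ not (onPair x y i)) ] ≡ 1
  #-outside-pair S ∣S∣≡3 x∈S y∈S = +-cancelˡ-≡ 2 _ _ (begin
    2 + #[ outside ]                                          ≡⟨ cong (_+ #[ outside ]) #-onPair ⟨
    #[ onPair x y ] + #[ outside ]                            ≡⟨ cong (_+ #[ outside ]) (#-cong inside) ⟨
    #[ (λ i → lookup S i ∧ onPair x y i) ] + #[ outside ]     ≡⟨ #-split (lookup S) (onPair x y) ⟨
    #[ lookup S ]                                             ≡⟨ ∣∣≡# S ⟨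
    ∣ S ∣                                                     ≡⟨ ∣S∣≡3 ⟩
    3                                                         ∎)
    where
    open ≡-Reasoning
    outside : Fin n → Bool
    outside i = lookup S i ∧ not (onPair x y i)
    inside : ∀ i → lookup S i ∧ onPair x y i ≡ onPair x y i
    inside i with onPair x y i in on
    ... | true  = trans (∧-identityʳ _) (Equivalence.to T-≡ (pair⊆ S x∈S y∈S i (subst T (sym on) _)))
    ... | false = ∧-zeroʳ _

  triple-through : (S : Subset n) → ∣ S ∣ ≡ 3 → T (lookup S x) → T (lookup S y) →
                   ∃ λ z → ¬ T (onPair x y z) × S ≡ triple x y z
  triple-through S ∣S∣≡3 x∈S y∈S with #-one (λ i → lookup S i ∧ not (onPair x y i)) (#-outside-pair S ∣S∣≡3 x∈S y∈S)
  ... | z , z-outside , unique = z , z∉xy , S≡triple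
    where
    z∈S : T (lookup S z)
    z∈S = proj₁ (T-∧⁻ z-outside)
    z∉xy : ¬ T (onPair x y z)
    z∉xy = T-not⁻ (proj₂ (T-∧⁻ {lookup S z} z-outside))
    pointwise : ∀ i → lookup S i ≡ onPair x y i ∨ does (i ≟ z)
    pointwise i = T-injective to from
      where
      to : T (lookup S i) → T (onPair x y i ∨ does (i ≟ z))
      to i∈S with onPair x y i in on
      ... | true  = _
      ... | false = subst (T ∘ does ∘ (_≟ z)) (sym (unique i (T-∧⁺ i∈S (subst (T ∘ not) (sym on) _)))) (≟-refl z)
      from : T (onPair x y i ∨ does (i ≟ z)) → T (lookup S i)
      from i∈ with T-∨⁻ i∈
      ... | inj₁ i∈xy = pair⊆ S x∈S y∈S i i∈xy
      ... | inj₂ i≡z  = subst (T ∘ lookup S) (sym (≟-sound i z i≡z)) z∈S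
    S≡triple : S ≡ triple x y z
    S≡triple = trans (sym (tabulate∘lookup S)) (Vec.tabulate-cong pointwise)

-- The embedding of ℕ into ℚ

-- ℕtoℚ a and ℤ.+ n / suc t compute to fromℚᵘ of the evident unnormalised fractions.
toℚᵘ-ℕtoℚ : ∀ a → toℚᵘ (ℕtoℚ a) ℚᵘ.≃ mkℚᵘ (ℤ.+ a) 0
toℚᵘ-ℕtoℚ a = toℚᵘ-fromℚᵘ (mkℚᵘ (ℤ.+ a) 0)

ℕtoℚ-homo-+ : ∀ a b → ℕtoℚ (a + b) ≡ ℕtoℚ a ℚ.+ ℕtoℚ b
ℕtoℚ-homo-+ a b = toℚᵘ-injective (begin
  toℚᵘ (ℕtoℚ (a + b))                 ≈⟨ toℚᵘ-ℕtoℚ (a + b) ⟩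
  mkℚᵘ (ℤ.+ (a + b)) 0                ≈⟨ *≡* (cong (ℤ._* ℤ.+ 1) (trans (ℤ.pos-+ a b) (sym numerator))) ⟩
  mkℚᵘ (ℤ.+ a) 0 ℚᵘ.+ mkℚᵘ (ℤ.+ b) 0  ≈⟨ ℚᵘ.+-cong (toℚᵘ-ℕtoℚ a) (toℚᵘ-ℕtoℚ b) ⟨
  toℚᵘ (ℕtoℚ a) ℚᵘ.+ toℚᵘ (ℕtoℚ b)    ≈⟨ toℚᵘ-homo-+ (ℕtoℚ a) (ℕtoℚ b) ⟨
  toℚᵘ (ℕtoℚ a ℚ.+ ℕtoℚ b)            ∎)
  where
  open ℚᵘ.≃-Reasoning
  numerator : ℤ.+ a ℤ.* ℤ.+ 1 ℤ.+ ℤ.+ b ℤ.* ℤ.+ 1 ≡ ℤ.+ a ℤ.+ ℤ.+ b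
  numerator = cong₂ ℤ._+_ (ℤ.*-identityʳ (ℤ.+ a)) (ℤ.*-identityʳ (ℤ.+ b))

ℕtoℚ-homo-* : ∀ a b → ℕtoℚ (a * b) ≡ ℕtoℚ a ℚ.* ℕtoℚ b
ℕtoℚ-homo-* a b = toℚᵘ-injective (begin
  toℚᵘ (ℕtoℚ (a * b))                 ≈⟨ toℚᵘ-ℕtoℚ (a * b) ⟩
  mkℚᵘ (ℤ.+ (a * b)) 0                ≈⟨ *≡* (cong (ℤ._* ℤ.+ 1) (ℤ.pos-* a b)) ⟩
  mkℚᵘ (ℤ.+ a) 0 ℚᵘ.* mkℚᵘ (ℤ.+ b) 0  ≈⟨ ℚᵘ.*-cong (toℚᵘ-ℕtoℚ a) (toℚᵘ-ℕtoℚ b) ⟨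
  toℚᵘ (ℕtoℚ a) ℚᵘ.* toℚᵘ (ℕtoℚ b)    ≈⟨ toℚᵘ-homo-* (ℕtoℚ a) (ℕtoℚ b) ⟨
  toℚᵘ (ℕtoℚ a ℚ.* ℕtoℚ b)            ∎)
  where open ℚᵘ.≃-Reasoning

ℕtoℚ-homo-^ : ∀ a k → ℕtoℚ (a ^ k) ≡ ℕtoℚ a ^ℚ k
ℕtoℚ-homo-^ a zero    = refl
ℕtoℚ-homo-^ a (suc k) = trans (ℕtoℚ-homo-* a (a ^ k)) (cong (ℕtoℚ a ℚ.*_) (ℕtoℚ-homo-^ a k))

ℕtoℚ-*-/ : ∀ n t → ℕtoℚ (suc t) ℚ.* (ℤ.+ n / suc t) ≡ ℕtoℚ n
ℕtoℚ-*-/ n t = toℚᵘ-injective (begin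
  toℚᵘ (ℕtoℚ (suc t) ℚ.* (ℤ.+ n / suc t))        ≈⟨ toℚᵘ-homo-* (ℕtoℚ (suc t)) (ℤ.+ n / suc t) ⟩
  toℚᵘ (ℕtoℚ (suc t)) ℚᵘ.* toℚᵘ (ℤ.+ n / suc t)  ≈⟨ ℚᵘ.*-cong (toℚᵘ-ℕtoℚ (suc t)) (toℚᵘ-fromℚᵘ (mkℚᵘ (ℤ.+ n) t)) ⟩
  mkℚᵘ (ℤ.+ suc t) 0 ℚᵘ.* mkℚᵘ (ℤ.+ n) t         ≈⟨ *≡* (solve 2 (λ u v → (u :* v) :* con (ℤ.+ 1) := v :* (con (ℤ.+ 1) :* u)) refl (ℤ.+ suc t) (ℤ.+ n)) ⟩
  mkℚᵘ (ℤ.+ n) 0                                 ≈⟨ toℚᵘ-ℕtoℚ n ⟨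
  toℚᵘ (ℕtoℚ n)                                  ∎)
  where open ℚᵘ.≃-Reasoning
        open +-*-Solver

^ℚ-distribˡ-+-* : ∀ q k j → q ^ℚ (k + j) ≡ q ^ℚ k ℚ.* q ^ℚ j
^ℚ-distribˡ-+-* q zero    j = sym (ℚ.*-identityˡ _)
^ℚ-distribˡ-+-* q (suc k) j = trans (cong (q ℚ.*_) (^ℚ-distribˡ-+-* q k j)) (sym (ℚ.*-assoc q _ _))

^ℚ-distribʳ-* : ∀ p q k → (p ℚ.* q) ^ℚ k ≡ p ^ℚ k ℚ.* q ^ℚ k
^ℚ-distribʳ-* p q zero    = refl
^ℚ-distribʳ-* p q (suc k) = trans (cong ((p ℚ.* q) ℚ.*_) (^ℚ-distribʳ-* p q k))
  (solve 4 (λ a b c d → (a :* b) :* (c :* d) := (a :* c) :* (b :* d)) refl p q (p ^ℚ k) (q ^ℚ k))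
  where open ℚ-Solver

ℕtoℚ-^-* : ∀ t k j → ℕtoℚ (suc (suc t) ^ k * suc t ^ j) ≡ ℕtoℚ (suc t ^ (k + j)) ℚ.* (ℤ.+ suc (suc t) / suc t) ^ℚ k
ℕtoℚ-^-* t k j = begin
  ℕtoℚ (suc (suc t) ^ k * suc t ^ j)          ≡⟨ ℕtoℚ-homo-* (suc (suc t) ^ k) (suc t ^ j) ⟩
  ℕtoℚ (suc (suc t) ^ k) ℚ.* ℕtoℚ (suc t ^ j) ≡⟨ cong₂ ℚ._*_ (ℕtoℚ-homo-^ (suc (suc t)) k) (ℕtoℚ-homo-^ (suc t) j) ⟩
  ℕtoℚ (suc (suc t)) ^ℚ k ℚ.* s ^ℚ j          ≡⟨ cong (λ q → q ^ℚ k ℚ.* s ^ℚ j) (ℕtoℚ-*-/ (suc (suc t)) t) ⟨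
  (s ℚ.* r) ^ℚ k ℚ.* s ^ℚ j                   ≡⟨ cong (ℚ._* s ^ℚ j) (^ℚ-distribʳ-* s r k) ⟩
  s ^ℚ k ℚ.* r ^ℚ k ℚ.* s ^ℚ j                ≡⟨ solve 3 (λ a b c → (a :* b) :* c := (a :* c) :* b) refl (s ^ℚ k) (r ^ℚ k) (s ^ℚ j) ⟩
  s ^ℚ k ℚ.* s ^ℚ j ℚ.* r ^ℚ k                ≡⟨ cong (ℚ._* r ^ℚ k) (^ℚ-distribˡ-+-* s k j) ⟨
  s ^ℚ (k + j) ℚ.* r ^ℚ k                     ≡⟨ cong (ℚ._* r ^ℚ k) (ℕtoℚ-homo-^ (suc t) (k + j)) ⟨
  ℕtoℚ (suc t ^ (k + j)) ℚ.* r ^ℚ k           ∎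
  where
  open ≡-Reasoning
  open ℚ-Solver
  s r : ℚ
  s = ℕtoℚ (suc t)
  r = ℤ.+ suc (suc t) / suc t

ℕtoℚ-sum : (f : A → ℕ) (xs : List A) → ℕtoℚ (sum (map f xs)) ≡ sumℚ (map (ℕtoℚ ∘ f) xs)
ℕtoℚ-sum f []       = refl
ℕtoℚ-sum f (x ∷ xs) = trans (ℕtoℚ-homo-+ (f x) _) (cong (ℕtoℚ (f x) ℚ.+_) (ℕtoℚ-sum f xs))

sumℚ-*ˡ : (c : ℚ) (f : A → ℚ) (xs : List A) → sumℚ (map (λ a → c ℚ.* f a) xs) ≡ c ℚ.* sumℚ (map f xs)
sumℚ-*ˡ c f []       = sym (ℚ.*-zeroʳ c)
sumℚ-*ˡ c f (x ∷ xs) = trans (cong (c ℚ.* f x ℚ.+_) (sumℚ-*ˡ c f xs)) (sym (ℚ.*-distribˡ-+ c (f x) _))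

-- The contribution of a single pair

module PairSum {m : ℕ} (B : Choice m) {x y : Fin m} (x≢y : x ≢ y) where

  unjoined : Fin m → Bool
  unjoined z = not (joinedBy B (triple x y z) x y)

  separating joining : Fin m → Bool
  separating z = not (onPair x y z) ∧ unjoined z
  joining    z = not (onPair x y z) ∧ not (unjoined z)

  pairIndicator : Subset m → Bool
  pairIndicator X = (x ∈ᵇ X) ∧ (y ∈ᵇ X) ∧ not (joinedIn B X x y)

  mxy≡#separating : mxy B x y ≡ #[ separating ]
  mxy≡#separating =
    trans (count-filter unjoinedTriple is3 (subsets m))
          (sum-subsets-image (λ S → is3 S ∧ unjoinedTriple S) (triple x y) separating
                             P⇒image image⇒P injective)
    where
    unjoinedTriple : Subset m → Bool
    unjoinedTriple S = (x ∈ᵇ S) ∧ (y ∈ᵇ S) ∧ not (joinedBy B S x y)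

    P⇒image : ∀ S → T (is3 S ∧ unjoinedTriple S) → ∃ λ z → T (separating z) × S ≡ triple x y z
    P⇒image S P with T-∧⁻ {is3 S} P
    ... | is3S , unjoinedS with T-∧⁻ {x ∈ᵇ S} unjoinedS
    ...   | x∈S , rest with T-∧⁻ {y ∈ᵇ S} rest
    ...     | y∈S , ¬joined with triple-through x≢y S (is3⇒∣∣≡3 S (Equivalence.to T-≡ is3S)) x∈S y∈S
    ...       | z , z∉xy , refl = z , T-∧⁺ {not (onPair x y z)} (T-not⁺ z∉xy) ¬joined , refl

    image⇒P : ∀ z → T (separating z) → T (is3 (triple x y z) ∧ unjoinedTriple (triple x y z))
    image⇒P z sep with T-∧⁻ {not (onPair x y z)} sep
    ... | z∉xy , unjoined-z =
      T-∧⁺ {is3 S} (Equivalence.from T-≡ (∣∣≡3⇒is3 S (∣triple∣ x≢y (T-not⁻ z∉xy))))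
           (T-∧⁺ {x ∈ᵇ S} (pair⊆triple x y z x (onPair-x x y))
                 (T-∧⁺ {y ∈ᵇ S} (pair⊆triple x y z y (onPair-y x y)) unjoined-z))
      where S = triple x y z

    injective : ∀ z w → T (separating z) → T (separating w) → triple x y z ≡ triple x y w → z ≡ w
    injective z w sep _ = triple-injective (T-not⁻ (proj₁ (T-∧⁻ {not (onPair x y z)} sep)))

  joinedIn⁺ : (X : Subset m) (z : Fin m) → T (lookup X x) → T (lookup X y) → T (lookup X z) →
              ¬ T (onPair x y z) → T (joinedBy B (triple x y z) x y) → T (joinedIn B X x y)
  joinedIn⁺ X z x∈X y∈X z∈X z∉xy joined =
    any⁺ (λ S → (S ⊆ᵇ X) ∧ joinedBy B S x y)
         (lose (∈-triples⁺ (triple x y z) (∣triple∣ x≢y z∉xy))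
               (T-∧⁺ {triple x y z ⊆ᵇ X} (⊆ᵇ⁺ (triple x y z) X triple⊆X) joined))
    where
    triple⊆X : ∀ i → T (lookup (triple x y z) i) → T (lookup X i)
    triple⊆X i i∈ with ∈-triple⁻ x y z i i∈
    ... | inj₁ i∈xy = pair⊆ X x∈X y∈X i i∈xy
    ... | inj₂ refl = z∈X

  joinedIn⁻ : (X : Subset m) → T (joinedIn B X x y) →
              ∃ λ z → ¬ T (onPair x y z) × T (lookup X z) × T (joinedBy B (triple x y z) x y)
  joinedIn⁻ X joined with find (any⁻ (λ S → (S ⊆ᵇ X) ∧ joinedBy B S x y) (triples m) joined)
  ... | S , S∈triples , S⊆X∧joined with T-∧⁻ {S ⊆ᵇ X} S⊆X∧joined
  ...   | S⊆X , S-joins with joinedBy⇒∈ B S S-joins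
  ...     | x∈S , y∈S with triple-through x≢y S (∈-triples⁻ S∈triples) x∈S y∈S
  ...       | z , z∉xy , refl = z , z∉xy , ⊆ᵇ⁻ S X S⊆X z (z∈triple x y z) , S-joins

  admissible : Fin m → Bool → Bool
  admissible i b = if onPair x y i then b else not b ∨ unjoined i

  admissible-on : ∀ i b → T (onPair x y i) → T (admissible i b) → T b
  admissible-on i b on adm with onPair x y i
  ... | true = adm

  admissible-off : ∀ i b → ¬ T (onPair x y i) → T (admissible i b) → T b → T (unjoined i)
  admissible-off i b off adm with onPair x y i
  ... | true  = ⊥-elim (off _)
  ... | false = T-⇒⁻ adm

  pairIndicator≡and : (X : Subset m) → pairIndicator X ≡ and (tabulate (λ i → admissible i (lookup X i)))
  pairIndicator≡and X = T-injective to from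
    where
    to : T (pairIndicator X) → T (and (tabulate (λ i → admissible i (lookup X i))))
    to ind with T-∧⁻ {x ∈ᵇ X} ind
    ... | x∈X , rest with T-∧⁻ {y ∈ᵇ X} rest
    ...   | y∈X , ¬joined = T-and-tabulate⁺ _ admissible-at
      where
      admissible-at : ∀ i → T (admissible i (lookup X i))
      admissible-at i with onPair x y i in on
      ... | true = pair⊆ X x∈X y∈X i (subst T (sym on) _)
      ... | false with lookup X i in i∈X | joinedBy B (triple x y i) x y in joins
      ...   | false | _     = _
      ...   | true  | false = _
      ...   | true  | true  =
        T-not⁻ ¬joined (joinedIn⁺ X i x∈X y∈X (subst T (sym i∈X) _) (subst T on) (subst T (sym joins) _))

    from : T (and (tabulate (λ i → admissible i (lookup X i)))) → T (pairIndicator X)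
    from all-admissible =
      T-∧⁺ {x ∈ᵇ X} x∈X (T-∧⁺ {y ∈ᵇ X} y∈X (T-not⁺ ¬joined))
      where
      adm : ∀ i → T (admissible i (lookup X i))
      adm = T-and-tabulate⁻ _ all-admissible
      x∈X = admissible-on x (lookup X x) (onPair-x x y) (adm x)
      y∈X = admissible-on y (lookup X y) (onPair-y x y) (adm y)
      ¬joined : ¬ T (joinedIn B X x y)
      ¬joined joined with joinedIn⁻ X joined
      ... | z , z∉xy , z∈X , joins = T-not⁻ (admissible-off z (lookup X z) z∉xy (adm z) z∈X) joins

  pair-sum : (s : ℕ) → sum (map (λ X → s ^ (m ∸ ∣ X ∣) * ⟦ pairIndicator X ⟧) (subsets m))
                       ≡ suc s ^ #[ separating ] * s ^ #[ joining ]
  pair-sum s = begin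
    sum (map (λ X → s ^ (m ∸ ∣ X ∣) * ⟦ pairIndicator X ⟧) (subsets m))
      ≡⟨ cong sum (map-cong summand≡∏ (subsets m)) ⟩
    sum (map (λ X → ∏ (λ i → g i (lookup X i))) (subsets m))
      ≡⟨ sum-subsets-∏ g ⟩
    ∏ (λ i → g i false + g i true)
      ≡⟨ ∏-cong factor ⟩
    ∏ (λ i → (if separating i then suc s else 1) * (if joining i then s else 1))
      ≡⟨ ∏-* {m} _ _ ⟩
    ∏ (λ i → if separating i then suc s else 1) * ∏ (λ i → if joining i then s else 1)
      ≡⟨ cong₂ _*_ (∏-if (suc s) separating) (∏-if s joining) ⟩
    suc s ^ #[ separating ] * s ^ #[ joining ] ∎
    where
    open ≡-Reasoning
    weight : Bool → ℕ
    weight b = if b then 1 else s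
    g : Fin m → Bool → ℕ
    g i b = ⟦ admissible i b ⟧ * weight b

    summand≡∏ : ∀ X → s ^ (m ∸ ∣ X ∣) * ⟦ pairIndicator X ⟧ ≡ ∏ (λ i → g i (lookup X i))
    summand≡∏ X = begin
      s ^ (m ∸ ∣ X ∣) * ⟦ pairIndicator X ⟧
        ≡⟨ cong₂ _*_ (^[n∸∣X∣]≡∏ s X) (trans (cong ⟦_⟧ (pairIndicator≡and X)) (⟦and⟧≡∏ {m} _)) ⟩
      ∏ (λ i → weight (lookup X i)) * ∏ (λ i → ⟦ admissible i (lookup X i) ⟧)
        ≡⟨ *-comm (∏ (λ i → weight (lookup X i))) _ ⟩
      ∏ (λ i → ⟦ admissible i (lookup X i) ⟧) * ∏ (λ i → weight (lookup X i))
        ≡⟨ ∏-* {m} _ _ ⟨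
      ∏ (λ i → g i (lookup X i)) ∎

    factor : ∀ i → g i false + g i true ≡ (if separating i then suc s else 1) * (if joining i then s else 1)
    factor i with onPair x y i | unjoined i
    ... | true  | _     = refl
    ... | false | true  = trans (cong (_+ 1) (+-identityʳ s)) (trans (+-comm s 1) (sym (*-identityʳ (suc s))))
    ... | false | false = +-identityʳ _

  #separating+#joining : #[ separating ] + #[ joining ] ≡ m ∸ 2
  #separating+#joining = begin
    #[ separating ] + #[ joining ]               ≡⟨ #-split (not ∘ onPair x y) unjoined ⟨
    #[ not ∘ onPair x y ]                        ≡⟨ m+n∸m≡n 2 _ ⟨
    2 + #[ not ∘ onPair x y ] ∸ 2                ≡⟨ cong (λ k → k + #[ not ∘ onPair x y ] ∸ 2) (#-onPair x≢y) ⟨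
    #[ onPair x y ] + #[ not ∘ onPair x y ] ∸ 2  ≡⟨ cong (_∸ 2) (#-complement (onPair x y)) ⟩
    m ∸ 2                                        ∎
    where open ≡-Reasoning

  pair-sumℚ : (t : ℕ) →
    ℕtoℚ (sum (map (λ X → suc t ^ (m ∸ ∣ X ∣) * ⟦ pairIndicator X ⟧) (subsets m)))
      ≡ ℕtoℚ (suc t ^ (m ∸ 2)) ℚ.* (ℤ.+ suc (suc t) / suc t) ^ℚ mxy B x y
  pair-sumℚ t = begin
    ℕtoℚ (sum (map (λ X → suc t ^ (m ∸ ∣ X ∣) * ⟦ pairIndicator X ⟧) (subsets m)))
      ≡⟨ cong ℕtoℚ (pair-sum (suc t)) ⟩
    ℕtoℚ (suc (suc t) ^ #[ separating ] * suc t ^ #[ joining ])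
      ≡⟨ ℕtoℚ-^-* t #[ separating ] #[ joining ] ⟩
    ℕtoℚ (suc t ^ (#[ separating ] + #[ joining ])) ℚ.* r ^ℚ #[ separating ]
      ≡⟨ cong₂ (λ e k → ℕtoℚ (suc t ^ e) ℚ.* r ^ℚ k) #separating+#joining (sym mxy≡#separating) ⟩
    ℕtoℚ (suc t ^ (m ∸ 2)) ℚ.* r ^ℚ mxy B x y ∎
    where
    open ≡-Reasoning
    r : ℚ
    r = ℤ.+ suc (suc t) / suc t

pairs-distinct : (m : ℕ) → All (λ p → Pair.fst p ≢ Pair.snd p) (pairs m)
pairs-distinct m = concat⁺ (map⁺ (All.universal (λ x → map⁺ (All.map Fin.<⇒≢ (all-filter (x <?_) (allFin m)))) (allFin m)))

lemma3p3 : (r : ℕ) (h : 3 ≤ r) (m : ℕ) (B : Choice m) → Good B →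
    ℕtoℚ (sum (map (λ X → nB B X * (r ∸ 2) ^ (m ∸ ∣ X ∣)) (subsets m)))
      ≡ Data.Rational._*_ (ℕtoℚ ((r ∸ 2) ^ (m ∸ 2)))
          (sumℚ (map (λ p → ratio r h ^ℚ mxy B (Pair.fst p) (Pair.snd p)) (pairs m)))
lemma3p3 1 (s≤s ()) m B _
lemma3p3 2 (s≤s (s≤s ())) m B _
lemma3p3 (suc (suc (suc t))) h m B _ = begin
  ℕtoℚ (sum (map (λ X → nB B X * weight X) (subsets m)))
    ≡⟨ cong ℕtoℚ (sum-map-count-comm weight indicator (subsets m) (pairs m)) ⟩
  ℕtoℚ (sum (map (λ p → sum (map (λ X → weight X * ⟦ indicator X p ⟧) (subsets m))) (pairs m)))
    ≡⟨ ℕtoℚ-sum _ (pairs m) ⟩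
  sumℚ (map (λ p → ℕtoℚ (sum (map (λ X → weight X * ⟦ indicator X p ⟧) (subsets m)))) (pairs m))
    ≡⟨ cong sumℚ (map-cong-local (All.map (λ x≢y → PairSum.pair-sumℚ B x≢y t) (pairs-distinct m))) ⟩
  sumℚ (map (λ p → ℕtoℚ (suc t ^ (m ∸ 2)) ℚ.* ratio _ h ^ℚ mxy B (Pair.fst p) (Pair.snd p)) (pairs m))
    ≡⟨ sumℚ-*ˡ (ℕtoℚ (suc t ^ (m ∸ 2))) (λ p → ratio _ h ^ℚ mxy B (Pair.fst p) (Pair.snd p)) (pairs m) ⟩
  ℕtoℚ (suc t ^ (m ∸ 2)) ℚ.* sumℚ (map (λ p → ratio _ h ^ℚ mxy B (Pair.fst p) (Pair.snd p)) (pairs m)) ∎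
  where
  open ≡-Reasoning
  weight : Subset m → ℕ
  weight X = suc t ^ (m ∸ ∣ X ∣)
  indicator : Subset m → Pair m → Bool
  indicator X p = (Pair.fst p ∈ᵇ X) ∧ (Pair.snd p ∈ᵇ X) ∧ not (joinedIn B X (Pair.fst p) (Pair.snd p))
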